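{- Let $j$ be a nonnegative integer and let $m,k$ be positive integers with $k\ge3$, $m$ odd, and $m\notin\mathcal{F}_j(k)$. Let $\delta(m)=\lceil\log_2(m/3)\rceil$. Then $k-1\ge 2^{\delta(m)}$.
   Context: The Thue–Morse word $\mathbf{t}=\mathbf{t}_1\mathbf{t}_2\mathbf{t}_3\cdots=0110100110010110\cdots$ is the infinite binary word whose $i$-th letter $\mathbf{t}_i$ ($i\ge 1$) is the parity of the number of 1's in the binary expansion of $i-1$. A $k$-anti-power is a word $w^{(1)}\cdots w^{(k)}$ with $w^{(1)},\dots,w^{(k)}$ pairwise distinct words of the same length. For $j\ge0$, the $j$-fix of $\mathbf{t}$ of length $N$ is $\mathbf{t}_{j+1}\cdots\mathbf{t}_{j+N}$. $\mathcal{F}_j(k)$ is the set of odd positive integers $m$ such that the $j$-fix of $\mathbf{t}$ of length $km$ is a $k$-anti-power. -}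

module Defs where

open import Data.Bool using (Bool; true; false; _xor_)
open import Data.Nat using (ℕ; zero; suc; _+_; _*_; _^_; _≡ᵇ_)
open import Data.Nat.DivMod using (_/_; _%_)
open import Data.Nat.Properties using (m^n≢0)
open import Data.Fin using (Fin; toℕ)
open import Data.List using (List; map; upTo)
open import Data.Integer using (ℤ; +_; -[1+_]; _-_)
open import Data.Rational using (ℚ; _≤_; _<_)
import Data.Rational as ℚ
open import Relation.Binary.PropositionalEquality using (_≡_; _≢_)
open import Data.Product using (_×_)

-- parity of the number of 1's in the binary expansion of n
-- (fuel-based recursion; fuel n suffices since n halves at each step)
parityBitsAux : ℕ → ℕ → Bool
parityBitsAux zero    _ = false
parityBitsAux (suc f) n = (n % 2 ≡ᵇ 1) xor parityBitsAux f (n / 2)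

parityBits : ℕ → Bool
parityBits n = parityBitsAux n n

-- Thue–Morse word, 1-indexed: t i = parity of popcount (i - 1), for i ≥ 1.
-- We use the 0-indexed version  tm p = t (p+1) = parityBits p.
tm : ℕ → Bool
tm p = parityBits p

-- the i-th block (i = 0,…,k-1) of length m of the j-fix of t of length k*m:
--   t_{j + i m + 1} ⋯ t_{j + (i+1) m}
block : (j m : ℕ) → ℕ → List Bool
block j m i = map (λ p → tm (j + i * m + p)) (upTo m)

IsAntiPowerFix : (j k m : ℕ) → Set
IsAntiPowerFix j k m = (a b : Fin k) → a ≢ b → block j m (toℕ a) ≢ block j m (toℕ b)

Odd : ℕ → Set
Odd m = m % 2 ≡ 1

InF : (j k m : ℕ) → Set
InF j k m = Odd m × IsAntiPowerFix j k m

pow2 : ℤ → ℚ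
pow2 (+ n)    = (+ (2 ^ n)) ℚ./ 1
pow2 -[1+ n ] = ℚ._/_ (+ 1) (2 ^ suc n) {{m^n≢0 2 (suc n)}}

IsCeilLog2 : ℚ → ℤ → Set
IsCeilLog2 x d = (x ≤ pow2 d) × (pow2 (d - + 1) < x)

module Submission where

-- If m is odd, m > 3·2ⁿ and k ≤ 2ⁿ⁺¹, then every j-fix of the Thue–Morse
-- word t of length km is a k-anti-power; the theorem is the contrapositive
-- read through δ = ⌈log₂(m/3)⌉, which gives 3·2^(δ-1) < m when δ ≥ 1.
--
-- The combinatorial heart is a statement about windows of t: two windows
-- of length 3·2ⁿ + 1 whose starting points differ by 2ᵉ·(odd) with e ≤ n
-- never coincide.  It is proved by induction on n using the recurrences
-- t(2h) = t(h) and t(2h+1) = ¬ t(h):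
--  * if the distance is odd, a window at an even and one at an odd position
--    of length 4 agree only if t contains three equal consecutive letters,
--    which it does not;
--  * if the distance is even, both windows start at positions of the same
--    parity and halve to windows of length 3·2ⁿ⁻¹ + 1 at half the distance.
-- Two equal blocks a < b of the j-fix are two coinciding windows of length m
-- at distance (b - a)·m, whose 2-adic valuation is that of b - a < 2ⁿ⁺¹.

open import Defs
open import Data.Bool using (false; not; _xor_)
open import Data.Bool.Properties using (not-injective; not-involutive; not-¬)
open import Data.Nat
  using (ℕ; zero; suc; _+_; _*_; _^_; _∸_; _≡ᵇ_; _≤_; _<_; _≥_; z≤n; s≤s; NonZero; _≤?_)
import Data.Nat as ℕ
open import Data.Nat.Properties
open import Data.Nat.DivMod using (_%_; m/n<m; m*n%n≡0; m*n/n≡m; [m+kn]%n≡m%n; +-distrib-/; m≡m%n+[m/n]*n)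
open import Data.Nat.Tactic.RingSolver using (solve-∀)
open import Data.List using (applyUpTo)
open import Data.List.Properties using (∷-injective; map-upTo)
open import Data.Fin using (toℕ)
open import Data.Fin.Properties using (toℕ-injective; toℕ<n)
open import Data.Integer using (ℤ; +_; -[1+_]; +≤+; +<+)
import Data.Integer as ℤ
import Data.Integer.Properties as ℤ
open import Data.Rational using (_/_)
import Data.Rational as ℚ
open import Data.Rational.Properties using (toℚᵘ-fromℚᵘ; toℚᵘ-cancel-≤; toℚᵘ-mono-<)
import Data.Rational.Unnormalised as ℚᵘ
import Data.Rational.Unnormalised.Properties as ℚᵘ
open import Data.Product using (Σ; _×_; _,_; proj₁; proj₂)
open import Relation.Binary using (tri<; tri≈; tri>)
open import Relation.Binary.PropositionalEquality
open import Relation.Nullary using (¬_; yes; no)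
open import Data.Empty using (⊥; ⊥-elim)

-- The fuel of `parityBitsAux` is irrelevant once it is at least the
-- argument, because the argument halves at every step.
parityBitsAux-zero : ∀ f → parityBitsAux f 0 ≡ false
parityBitsAux-zero zero    = refl
parityBitsAux-zero (suc f) = parityBitsAux-zero f

half-≤ : ∀ n f → n ≤ suc f → n ℕ./ 2 ≤ f
half-≤ zero      f _   = z≤n
half-≤ n@(suc _) f n≤ = ≤-pred (≤-trans (m/n<m n 2 (s≤s (s≤s z≤n))) n≤)

parityBitsAux-fuel : ∀ f g n → n ≤ f → n ≤ g → parityBitsAux f n ≡ parityBitsAux g n
parityBitsAux-fuel zero    g       .zero z≤n _   = sym (parityBitsAux-zero g)
parityBitsAux-fuel (suc f) zero    .zero z≤n z≤n = parityBitsAux-zero (suc f)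
parityBitsAux-fuel (suc f) (suc g) n     n≤f n≤g =
  cong ((n % 2 ≡ᵇ 1) xor_) (parityBitsAux-fuel f g (n ℕ./ 2) (half-≤ n f n≤f) (half-≤ n g n≤g))

tm-unfold : ∀ n → tm n ≡ ((n % 2 ≡ᵇ 1) xor tm (n ℕ./ 2))
tm-unfold zero      = refl
tm-unfold n@(suc f) =
  cong ((n % 2 ≡ᵇ 1) xor_) (parityBitsAux-fuel f (n ℕ./ 2) (n ℕ./ 2) (half-≤ n f ≤-refl) ≤-refl)

tm-double : ∀ h → tm (h + h) ≡ tm h
tm-double h = begin
  tm (h + h)                                    ≡⟨ cong tm (double≡*2 h) ⟩
  tm (h * 2)                                    ≡⟨ tm-unfold (h * 2) ⟩
  ((h * 2 % 2 ≡ᵇ 1) xor tm (h * 2 ℕ./ 2))       ≡⟨ cong₂ (λ r q → (r ≡ᵇ 1) xor tm q) (m*n%n≡0 h 2) (m*n/n≡m h 2) ⟩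
  tm h                                          ∎
  where
  open ≡-Reasoning
  double≡*2 : ∀ h → h + h ≡ h * 2
  double≡*2 = solve-∀

tm-double+1 : ∀ h → tm (suc (h + h)) ≡ not (tm h)
tm-double+1 h = begin
  tm (suc (h + h))                                          ≡⟨ cong tm (double+1≡ h) ⟩
  tm (1 + h * 2)                                            ≡⟨ tm-unfold (1 + h * 2) ⟩
  (((1 + h * 2) % 2 ≡ᵇ 1) xor tm ((1 + h * 2) ℕ./ 2))       ≡⟨ cong₂ (λ r q → (r ≡ᵇ 1) xor tm q) ([m+kn]%n≡m%n 1 h 2) half ⟩
  not (tm h)                                                ∎
  where
  open ≡-Reasoning
  double+1≡ : ∀ h → suc (h + h) ≡ 1 + h * 2
  double+1≡ = solve-∀
  half : (1 + h * 2) ℕ./ 2 ≡ h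
  half = trans (+-distrib-/ 1 (h * 2) (subst (λ r → 1 + r < 2) (sym (m*n%n≡0 h 2)) ≤-refl))
               (m*n/n≡m h 2)

data Parity : ℕ → Set where
  even : ∀ h → Parity (h + h)
  odd  : ∀ h → Parity (suc (h + h))

parity : ∀ n → Parity n
parity zero = even 0
parity (suc n) with parity n
... | even h = odd h
... | odd h  = subst Parity (cong suc (+-suc h h)) (even (suc h))

neighbours-differ : ∀ h → tm (h + h) ≡ tm (suc (h + h)) → ⊥
neighbours-differ h eq = not-¬ refl (trans (sym (tm-double h)) (trans eq (tm-double+1 h)))

-- t contains no factor 000 or 111: among t(c), t(c+1), t(c+2) two
-- neighbours are of the form t(2h), t(2h+1).
no-triple : ∀ c → tm c ≡ tm (suc c) → tm (suc c) ≡ tm (suc (suc c)) → ⊥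
no-triple c first second with parity c
... | even h = neighbours-differ h first
... | odd h  = neighbours-differ (suc h) (subst (λ n → tm n ≡ tm (suc n)) 2h+2≡ second)
  where
  2h+2≡ : suc (suc (h + h)) ≡ suc h + suc h
  2h+2≡ = cong suc (sym (+-suc h h))

tm-even+even : ∀ h i → tm ((h + h) + (i + i)) ≡ tm (h + i)
tm-even+even h i = trans (cong tm (regroup h i)) (tm-double (h + i))
  where
  regroup : ∀ h i → (h + h) + (i + i) ≡ (h + i) + (h + i)
  regroup = solve-∀

tm-odd+even : ∀ h i → tm (suc (h + h) + (i + i)) ≡ not (tm (h + i))
tm-odd+even h i = trans (cong tm (regroup h i)) (tm-double+1 (h + i))
  where
  regroup : ∀ h i → suc (h + h) + (i + i) ≡ suc ((h + i) + (h + i))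
  regroup = solve-∀

tm-even+odd : ∀ h i → tm ((h + h) + suc (i + i)) ≡ not (tm (h + i))
tm-even+odd h i = trans (cong tm (regroup h i)) (tm-double+1 (h + i))
  where
  regroup : ∀ h i → (h + h) + suc (i + i) ≡ suc ((h + i) + (h + i))
  regroup = solve-∀

tm-odd+odd : ∀ h i → tm (suc (h + h) + suc (i + i)) ≡ tm (suc (h + i))
tm-odd+odd h i = trans (cong tm (regroup h i)) (tm-double (suc (h + i)))
  where
  regroup : ∀ h i → suc (h + h) + suc (i + i) ≡ suc (h + i) + suc (h + i)
  regroup = solve-∀

record Agree (x y L : ℕ) : Set where
  constructor agreeing
  field letterAt : ∀ i → i < L → tm (x + i) ≡ tm (y + i)
open Agree

agree-sym : ∀ {x y L} → Agree x y L → Agree y x L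
agree-sym agree = agreeing λ i i<L → sym (letterAt agree i i<L)

agree-shrink : ∀ {x y L L′} → L′ ≤ L → Agree x y L → Agree x y L′
agree-shrink L′≤L agree = agreeing λ i i<L′ → letterAt agree i (<-≤-trans i<L′ L′≤L)

even-odd-step : ∀ a b i → tm ((a + a) + (i + i)) ≡ tm (suc (b + b) + (i + i)) →
                tm ((a + a) + suc (i + i)) ≡ tm (suc (b + b) + suc (i + i)) →
                tm (b + i) ≡ tm (suc (b + i))
even-odd-step a b i at-2i at-2i+1 = begin
  tm (b + i)              ≡⟨ sym (not-involutive (tm (b + i))) ⟩
  not (not (tm (b + i)))  ≡⟨ cong not (sym halved-2i) ⟩
  not (tm (a + i))        ≡⟨ halved-2i+1 ⟩
  tm (suc (b + i))        ∎
  where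
  open ≡-Reasoning
  halved-2i : tm (a + i) ≡ not (tm (b + i))
  halved-2i = trans (sym (tm-even+even a i)) (trans at-2i (tm-odd+even b i))
  halved-2i+1 : not (tm (a + i)) ≡ tm (suc (b + i))
  halved-2i+1 = trans (sym (tm-even+odd a i)) (trans at-2i+1 (tm-odd+odd b i))

-- Base case: windows of length 4 at an even and at an odd position differ,
-- since otherwise t(b) = t(b+1) = t(b+2).
even-vs-odd : ∀ a b → ¬ Agree (a + a) (suc (b + b)) 4
even-vs-odd a b agree = no-triple b first second
  where
  first : tm b ≡ tm (suc b)
  first = subst (λ c → tm c ≡ tm (suc c)) (+-identityʳ b)
            (even-odd-step a b 0 (letterAt agree 0 (s≤s z≤n)) (letterAt agree 1 (s≤s (s≤s z≤n))))
  second : tm (suc b) ≡ tm (suc (suc b))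
  second = subst (λ c → tm c ≡ tm (suc c)) (+-comm b 1)
             (even-odd-step a b 1 (letterAt agree 2 (s≤s (s≤s (s≤s z≤n)))) (letterAt agree 3 (s≤s (s≤s (s≤s (s≤s z≤n))))))

window : ℕ → ℕ
window n = suc (3 * 2 ^ n)

4≤window : ∀ n → 4 ≤ window n
4≤window n = s≤s (*-monoʳ-≤ 3 (m^n>0 2 n))

double-in-window : ∀ n i → i < window n → i + i < window (suc n)
double-in-window n i (s≤s i≤) = s≤s (subst (i + i ≤_) (twice (2 ^ n)) (+-mono-≤ i≤ i≤))
  where
  twice : ∀ p → 3 * p + 3 * p ≡ 3 * (2 * p)
  twice = solve-∀

agree-halve-even : ∀ n a b → Agree (a + a) (b + b) (window (suc n)) → Agree a b (window n)
agree-halve-even n a b agree = agreeing λ i i< → begin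
  tm (a + i)               ≡⟨ sym (tm-even+even a i) ⟩
  tm ((a + a) + (i + i))   ≡⟨ letterAt agree (i + i) (double-in-window n i i<) ⟩
  tm ((b + b) + (i + i))   ≡⟨ tm-even+even b i ⟩
  tm (b + i)               ∎
  where open ≡-Reasoning

agree-halve-odd : ∀ n a b → Agree (suc (a + a)) (suc (b + b)) (window (suc n)) → Agree a b (window n)
agree-halve-odd n a b agree = agreeing λ i i< → not-injective (begin
  not (tm (a + i))               ≡⟨ sym (tm-odd+even a i) ⟩
  tm (suc (a + a) + (i + i))     ≡⟨ letterAt agree (i + i) (double-in-window n i i<) ⟩
  tm (suc (b + b) + (i + i))     ≡⟨ tm-odd+even b i ⟩
  not (tm (b + i))               ∎)
  where open ≡-Reasoning

windows-differ : ∀ n e o x y → e ≤ n → y ≡ x + 2 ^ e * suc (o + o) → ¬ Agree x y (window n)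
windows-differ n zero o x y _ y≡ agree with parity x
... | even a = even-vs-odd a (a + o)
                 (subst (λ z → Agree (a + a) z 4) (trans y≡ (even+odd a o)) (agree-shrink (4≤window n) agree))
  where
  even+odd : ∀ a o → (a + a) + 1 * suc (o + o) ≡ suc ((a + o) + (a + o))
  even+odd = solve-∀
... | odd a = even-vs-odd (suc (a + o)) a
                (agree-sym (subst (λ z → Agree (suc (a + a)) z 4) (trans y≡ (odd+odd a o))
                  (agree-shrink (4≤window n) agree)))
  where
  odd+odd : ∀ a o → suc (a + a) + 1 * suc (o + o) ≡ suc (a + o) + suc (a + o)
  odd+odd = solve-∀
windows-differ (suc n) (suc e) o x y (s≤s e≤n) y≡ agree with parity x
... | even a = windows-differ n e o a (a + 2 ^ e * suc (o + o)) e≤n refl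
                 (agree-halve-even n a _ (subst (λ z → Agree (a + a) z (window (suc n)))
                   (trans y≡ (halve a (2 ^ e) (suc (o + o)))) agree))
  where
  halve : ∀ a p s → (a + a) + (2 * p) * s ≡ (a + p * s) + (a + p * s)
  halve = solve-∀
... | odd a = windows-differ n e o a (a + 2 ^ e * suc (o + o)) e≤n refl
                (agree-halve-odd n a _ (subst (λ z → Agree (suc (a + a)) z (window (suc n)))
                  (trans y≡ (halve a (2 ^ e) (suc (o + o)))) agree))
  where
  halve : ∀ a p s → suc (a + a) + (2 * p) * s ≡ suc ((a + p * s) + (a + p * s))
  halve = solve-∀

half-< : ∀ h p → h + h < 2 * p → h < p
half-< h p h+h<2p = *-cancelˡ-< 2 h p (subst (_< 2 * p) (double≡ h) h+h<2p)
  where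
  double≡ : ∀ h → h + h ≡ 2 * h
  double≡ = solve-∀

two-adic : ∀ n d → 1 ≤ d → d < 2 ^ suc n →
           Σ ℕ λ e → Σ ℕ λ o → e ≤ n × d ≡ 2 ^ e * suc (o + o)
two-adic n d 1≤d d<2ⁿ⁺¹ with parity d
two-adic n       _ _  _                 | odd h        = 0 , h , z≤n , sym (*-identityˡ (suc (h + h)))
two-adic n       _ () _                 | even zero
two-adic zero    _ _  (s≤s (s≤s 2h<0)) | even (suc h) = ⊥-elim (n≮0 (m+n≤o⇒n≤o h 2h<0))
two-adic (suc n) _ _  d<2ⁿ⁺¹            | even (suc h)
  with two-adic n (suc h) (s≤s z≤n) (half-< (suc h) (2 ^ suc n) d<2ⁿ⁺¹)
... | e , o , e≤n , h≡ = suc e , o , s≤s e≤n , trans (cong (λ z → z + z) h≡) (doubling (2 ^ e) (suc (o + o)))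
  where
  doubling : ∀ p s → p * s + p * s ≡ 2 * p * s
  doubling = solve-∀

applyUpTo-pointwise : ∀ {A : Set} (f g : ℕ → A) n → applyUpTo f n ≡ applyUpTo g n →
                      ∀ i → i < n → f i ≡ g i
applyUpTo-pointwise f g (suc n) eq zero    _         = proj₁ (∷-injective eq)
applyUpTo-pointwise f g (suc n) eq (suc i) (s≤s i<n) =
  applyUpTo-pointwise (λ p → f (suc p)) (λ p → g (suc p)) n (proj₂ (∷-injective eq)) i i<n

equal-blocks-agree : ∀ j m a b → block j m a ≡ block j m b → Agree (j + a * m) (j + b * m) m
equal-blocks-agree j m a b eq =
  agreeing (applyUpTo-pointwise _ _ m (trans (sym (map-upTo _ m)) (trans eq (map-upTo _ m))))

odd-form : ∀ m → Odd m → m ≡ suc (m ℕ./ 2 + m ℕ./ 2)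
odd-form m m-odd = begin
  m                             ≡⟨ m≡m%n+[m/n]*n m 2 ⟩
  m % 2 + (m ℕ./ 2) * 2          ≡⟨ cong₂ _+_ m-odd (*-comm (m ℕ./ 2) 2) ⟩
  1 + 2 * (m ℕ./ 2)              ≡⟨ cong (λ z → suc (m ℕ./ 2 + z)) (+-identityʳ (m ℕ./ 2)) ⟩
  suc (m ℕ./ 2 + m ℕ./ 2)        ∎
  where open ≡-Reasoning

-- Multiplying a distance 2ᵉ·(2o+1) by an odd number 2q+1 keeps its 2-adic
-- valuation: the odd part becomes 2r+1 with r = 2oq + o + q.
scaled-distance : ∀ x a p o q →
  x + (a + p * suc (o + o)) * suc (q + q) ≡
  (x + a * suc (q + q)) + p * suc ((o * q + o * q + o + q) + (o * q + o * q + o + q))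
scaled-distance = solve-∀

-- Blocks a < b < k ≤ 2ⁿ⁺¹ of length m > 3·2ⁿ, m odd, are different: their
-- distance (b-a)·m is 2ᵉ·(odd) with e ≤ n.
blocks-differ : ∀ j m k n → window n ≤ m → k ≤ 2 ^ suc n → Odd m →
                ∀ a b → a < b → b < k → block j m a ≢ block j m b
blocks-differ j m k n m-large k-small m-odd a b a<b b<k eq
  with two-adic n (b ∸ a) (m<n⇒0<n∸m a<b) (<-≤-trans (≤-<-trans (m∸n≤m b a) b<k) k-small)
... | e , o , e≤n , b-a≡ =
  windows-differ n e r (j + a * m) (j + b * m) e≤n distance
    (agree-shrink m-large (equal-blocks-agree j m a b eq))
  where
  q = m ℕ./ 2
  r = o * q + o * q + o + q
  b≡ : b ≡ a + 2 ^ e * suc (o + o)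
  b≡ = trans (sym (m+[n∸m]≡n (<⇒≤ a<b))) (cong (λ d → a + d) b-a≡)
  m≡ : m ≡ suc (q + q)
  m≡ = odd-form m m-odd
  distance : j + b * m ≡ j + a * m + 2 ^ e * suc (r + r)
  distance = begin
    j + b * m                                   ≡⟨ cong (λ c → j + c * m) b≡ ⟩
    j + (a + 2 ^ e * suc (o + o)) * m           ≡⟨ cong (λ z → j + (a + 2 ^ e * suc (o + o)) * z) m≡ ⟩
    j + (a + 2 ^ e * suc (o + o)) * suc (q + q) ≡⟨ scaled-distance j a (2 ^ e) o q ⟩
    j + a * suc (q + q) + 2 ^ e * suc (r + r)   ≡⟨ cong (λ z → j + a * z + 2 ^ e * suc (r + r)) (sym m≡) ⟩
    j + a * m + 2 ^ e * suc (r + r)             ∎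
    where open ≡-Reasoning

anti-power : ∀ j m k n → window n ≤ m → k ≤ 2 ^ suc n → Odd m → IsAntiPowerFix j k m
anti-power j m k n m-large k-small m-odd a b a≢b eq with <-cmp (toℕ a) (toℕ b)
... | tri< a<b _ _ = blocks-differ j m k n m-large k-small m-odd (toℕ a) (toℕ b) a<b (toℕ<n b) eq
... | tri≈ _ a≡b _ = a≢b (toℕ-injective a≡b)
... | tri> _ _ b<a = blocks-differ j m k n m-large k-small m-odd (toℕ b) (toℕ a) b<a (toℕ<n a) (sym eq)

-- Nonnegative fractions compare by cross-multiplication (the library's
-- order on ℚ is stated on normalised forms, hence the detour through ℚᵘ).
/-≤-cross : ∀ a b c d .{{_ : NonZero b}} .{{_ : NonZero d}} → a * d ≤ c * b → (+ a / b) ℚ.≤ (+ c / d)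
/-≤-cross a (suc b) c (suc d) ad≤cb = toℚᵘ-cancel-≤
  (ℚᵘ.≤-respˡ-≃ (ℚᵘ.≃-sym (toℚᵘ-fromℚᵘ (ℚᵘ.mkℚᵘ (+ a) b)))
  (ℚᵘ.≤-respʳ-≃ (ℚᵘ.≃-sym (toℚᵘ-fromℚᵘ (ℚᵘ.mkℚᵘ (+ c) d)))
    (ℚᵘ.*≤* (subst₂ ℤ._≤_ (ℤ.pos-* a (suc d)) (ℤ.pos-* c (suc b)) (+≤+ ad≤cb)))))

/-<-cross : ∀ a b c d .{{_ : NonZero b}} .{{_ : NonZero d}} → (+ a / b) ℚ.< (+ c / d) → a * d < c * b
/-<-cross a (suc b) c (suc d) a/b<c/d with ℚᵘ.<-respˡ-≃ (toℚᵘ-fromℚᵘ (ℚᵘ.mkℚᵘ (+ a) b))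
  (ℚᵘ.<-respʳ-≃ (toℚᵘ-fromℚᵘ (ℚᵘ.mkℚᵘ (+ c) d)) (toℚᵘ-mono-< a/b<c/d))
... | ℚᵘ.*<* ad<cb with subst₂ ℤ._<_ (sym (ℤ.pos-* a (suc d))) (sym (ℤ.pos-* c (suc b))) ad<cb
... | +<+ ad<cb′ = ad<cb′

window-below : ∀ n m → pow2 (+ n) ℚ.< (+ m) / 3 → window n ≤ m
window-below n m 2ⁿ<m/3 = subst₂ _<_ (*-comm (2 ^ n) 3) (*-identityʳ m) (/-<-cross (2 ^ n) 1 m 3 2ⁿ<m/3)

-- For δ ≤ 0 the bound is 2^δ ≤ 1 < k - 1.  For δ = n+1, either 2ⁿ⁺¹ ≤ k - 1,
-- or k ≤ 2ⁿ⁺¹ and then m ∈ 𝓕_j(k) by `anti-power`, contradicting the hypothesis.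
mainTheorem6 : (j m k : ℕ) → m ≥ 1 → k ≥ 3 → Odd m → ¬ InF j k m →
    (δ : ℤ) → IsCeilLog2 ((+ m) / 3) δ → pow2 δ ℚ.≤ (+ (k ∸ 1)) / 1
mainTheorem6 j m (suc k) _ (s≤s 2≤k) m-odd m∉F -[1+ n ] _ =
  /-≤-cross 1 (2 ^ suc n) k 1 {{m^n≢0 2 (suc n)}} (*-mono-≤ (≤-trans (s≤s z≤n) 2≤k) (m^n>0 2 (suc n)))
mainTheorem6 j m (suc k) _ (s≤s 2≤k) m-odd m∉F (+ zero) _ =
  /-≤-cross 1 1 k 1 (*-monoˡ-≤ 1 (≤-trans (s≤s z≤n) 2≤k))
mainTheorem6 j m (suc k) _ _ m-odd m∉F (+ suc n) (_ , 2ⁿ<m/3) with 2 ^ suc n ≤? k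
... | yes 2ⁿ⁺¹≤k = /-≤-cross (2 ^ suc n) 1 k 1 (*-monoˡ-≤ 1 2ⁿ⁺¹≤k)
... | no  2ⁿ⁺¹≰k = ⊥-elim (m∉F (m-odd , anti-power j m (suc k) n (window-below n m 2ⁿ<m/3) (≰⇒> 2ⁿ⁺¹≰k) m-odd))
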